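{- Let $G=\langle B,\rho\tau_0^{\epsilon},\sigma\tau_0^{\epsilon}\tau_J\rangle$ be an arc-transitive subgroup of $\mathrm{Aut}(\mathrm{C}_n^{(2)})$, where $B\leq K$ is nontrivial and normal in $G$, $\epsilon\in\{0,1\}$ is such that $\tau_{\mathbb{Z}_n}^{\epsilon}\in B$, and $J\subseteq\mathbb{Z}_n$ is such that $\tau_J\tau_{ -J}\in B$ and $\tau_J\tau_{J+1}\in B$. Suppose that $B$ has exact period $k\geq 1$. If $B$ is equal to the largest subgroup of $K$ with exact period $k$, then $G=\langle B,\rho\tau_0^{\epsilon},\sigma\tau_0^{\epsilon}\tau_L\rangle$, where either $\tau_L=\tau_{\mathbb{Z}_n}$, or else $2k\mid n$ and $\tau_L=\prod_{i=0}^{k-1}\tau_{[i,2k]}$.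
   Context: $\mathrm{C}_n^{(2)}$ is the doubled cycle of length $n$: vertex set $\mathbb{Z}_n$ and two distinct edges between $i$ and $i+1$, with $a_i,b_i$ the two arcs from $i$ to $i+1$. Its automorphisms include the elementary transpositions $\tau_j=(a_j\,b_j)$, the reflection $\sigma$ given by $a_i^\sigma=(a_{ -i})^{ -1}$, $b_i^\sigma=(b_{ -i})^{ -1}$, and the rotation $\rho=(a_0a_1\ldots a_{n-1})(b_0b_1\ldots b_{n-1})$. $K=\langle\tau_0,\ldots,\tau_{n-1}\rangle\cong\mathbb{Z}_2^n$, and for $J\subseteq\mathbb{Z}_n$, $\tau_J=\prod_{j\in J}\tau_j$, $J+k=\{j+k: j\in J\}$, $-J=\{ -j:j\in J\}$; so $\tau_J^\rho=\tau_{J+1}$, $\tau_J^\sigma=\tau_{ -J}$. An integer $k$, $1\le k\le n$, is a period of a subgroup $H\le K$ if $\rho^k$ centralizes $H$, equivalently $\tau_{L+k}=\tau_L$ for all $\tau_L\in H$; the exact period is the smallest positive period (a divisor of $n$). For a divisor $k$ of $n$, $\tau_{[i,k]}=\tau_i\tau_{i+k}\tau_{i+2k}\cdots\tau_{i+(n/k-1)k}$; the largest subgroup of $K$ with exact period $k$ is $\langle\tau_{[0,k]},\ldots,\tau_{[k-1,k]}\rangle\cong\mathbb{Z}_2^k$. -}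

module Defs where

open import Data.Nat using (ℕ; zero; suc; _+_; _*_; _∸_; _≤_; NonZero)
open import Data.Nat.DivMod using (_%_; m%n<n)
open import Data.Nat.Divisibility using (_∣_)
open import Data.Fin using (Fin; toℕ; fromℕ<)
open import Data.Bool using (Bool; true; false; not; if_then_else_; _xor_; T)
open import Data.Product using (_×_; _,_; Σ; ∃)
open import Data.Sum using (_⊎_)
open import Relation.Binary.PropositionalEquality using (_≡_)
open import Function using (id)
import Relation.Nullary.Decidable.Core
import Data.Fin
import Data.Nat

-- Z_n, represented by Fin n (n ≥ 1).  Arithmetic modulo n.
finMod : {n : ℕ} .{{_ : NonZero n}} → ℕ → Fin n
finMod {n} m = fromℕ< (m%n<n m n)

_+ᶠ_ : {n : ℕ} .{{_ : NonZero n}} → Fin n → ℕ → Fin n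
_+ᶠ_ {n} j k = finMod (toℕ j + k)

_-ᶠ_ : {n : ℕ} .{{_ : NonZero n}} → Fin n → ℕ → Fin n
_-ᶠ_ {n} j k = finMod (toℕ j + (n ∸ (k % n)))

negᶠ : {n : ℕ} .{{_ : NonZero n}} → Fin n → Fin n
negᶠ {n} j = finMod (n ∸ toℕ j)

-- Subsets J ⊆ Z_n (these index the elements τ_J of K ≅ Z_2^n)

Sub : ℕ → Set
Sub n = Fin n → Bool

_≗ˢ_ : {n : ℕ} → Sub n → Sub n → Set
L ≗ˢ M = ∀ j → L j ≡ M j

∅ˢ : {n : ℕ} → Sub n
∅ˢ _ = false

fullˢ : {n : ℕ} → Sub n
fullˢ _ = true

single : {n : ℕ} → Fin n → Sub n
single j i = Relation.Nullary.Decidable.Core.does (Data.Fin._≟_ i j)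

-- symmetric difference: τ_L τ_M = τ_{L ⊕ M}
_⊕_ : {n : ℕ} → Sub n → Sub n → Sub n
(L ⊕ M) j = L j xor M j

_+ˢ_ : {n : ℕ} .{{_ : NonZero n}} → Sub n → ℕ → Sub n
(L +ˢ k) j = L (j -ᶠ k)

negˢ : {n : ℕ} .{{_ : NonZero n}} → Sub n → Sub n
negˢ L j = L (negᶠ j)

-- [i,k] = { j ∈ Z_n : j ≡ i (mod k) }, so τ_[i,k] = τ_i τ_{i+k} ⋯   (k ∣ n)
bracket : {n : ℕ} → (k i : ℕ) → Sub n
bracket zero i j = false
bracket (suc k) i j = Data.Nat._≡ᵇ_ (toℕ j % suc k) i

xorSum : {n : ℕ} → ℕ → (ℕ → Sub n) → Sub n
xorSum zero f = ∅ˢ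
xorSum (suc m) f = xorSum m f ⊕ f m

prodBracket : {n : ℕ} → ℕ → Sub n
prodBracket k = xorSum k (λ i → bracket (2 * k) i)

-- B ≤ K : a subgroup of K ≅ Z_2^n, given by the set of subsets L with τ_L ∈ B
record IsSubgroupK {n : ℕ} (B : Sub n → Set) : Set where
  field
    has-∅   : B ∅ˢ
    closed-⊕ : ∀ {L M} → B L → B M → B (L ⊕ M)
    resp    : ∀ {L M} → L ≗ˢ M → B L → B M

IsPeriod : {n : ℕ} .{{_ : NonZero n}} → (Sub n → Set) → ℕ → Set
IsPeriod {n} B k = 1 ≤ k × k ≤ n × (∀ L → B L → (L +ˢ k) ≗ˢ L)

IsExactPeriod : {n : ℕ} .{{_ : NonZero n}} → (Sub n → Set) → ℕ → Set
IsExactPeriod B k = IsPeriod B k × (∀ k′ → IsPeriod B k′ → k ≤ k′)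

-- the largest subgroup of K with exact period k : ⟨τ_[0,k], …, τ_[k-1,k]⟩
LargestK : {n : ℕ} → ℕ → Sub n → Set
LargestK {n} k L = Σ (ℕ → Bool) λ c →
  L ≗ˢ xorSum k (λ i → if c i then bracket k i else ∅ˢ)

-- Arcs of C_n^(2): (i , letter , dir) where letter false = a, true = b,
-- dir false = the arc a_i / b_i  (i → i+1), dir true = its inverse.

Arc : ℕ → Set
Arc n = Fin n × Bool × Bool

-- permutations of arcs; automorphisms are determined by their action on arcs
Perm : ℕ → Set
Perm n = Arc n → Arc n

_≗ᵖ_ : {n : ℕ} → Perm n → Perm n → Set
g ≗ᵖ h = ∀ x → g x ≡ h x

-- product with right action convention: x^(g·h) = (x^g)^h
_·_ : {n : ℕ} → Perm n → Perm n → Perm n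
(g · h) x = h (g x)

τ : {n : ℕ} → Sub n → Perm n
τ J (i , l , d) = (i , (if J i then not l else l) , d)

ρ : {n : ℕ} .{{_ : NonZero n}} → Perm n
ρ (i , l , d) = (i +ᶠ 1 , l , d)

σ : {n : ℕ} .{{_ : NonZero n}} → Perm n
σ (i , l , d) = (negᶠ i , l , not d)

τ₀^ : {n : ℕ} .{{_ : NonZero n}} → Bool → Perm n
τ₀^ false = id
τ₀^ true = τ (single (finMod 0))

data Gen {n : ℕ} (S : Perm n → Set) : Perm n → Set where
  gen : ∀ {g} → S g → Gen S g
  one : Gen S id
  mul : ∀ {g h} → Gen S g → Gen S h → Gen S (g · h)
  inv : ∀ {g h} → Gen S g → (∀ x → h (g x) ≡ x) → (∀ x → g (h x) ≡ x) → Gen S h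

_∈⟨_⟩ : {n : ℕ} → Perm n → (Perm n → Set) → Set
g ∈⟨ S ⟩ = Σ _ λ h → Gen S h × h ≗ᵖ g

GensB : {n : ℕ} → (Sub n → Set) → Perm n → Perm n → Perm n → Set
GensB B x y g = (Σ _ λ L → B L × g ≗ᵖ τ L) ⊎ (g ≗ᵖ x ⊎ g ≗ᵖ y)

SameGroup : {n : ℕ} → (Sub n → Set) → Perm n → Perm n → Perm n → Perm n → Set
SameGroup B x y x′ y′ =
  ∀ g → (g ∈⟨ GensB B x y ⟩ → g ∈⟨ GensB B x′ y′ ⟩) × (g ∈⟨ GensB B x′ y′ ⟩ → g ∈⟨ GensB B x y ⟩)

ArcTransitive : {n : ℕ} → (Perm n → Set) → Set
ArcTransitive {n} S = ∀ (x y : Arc n) → Σ _ λ g → g ∈⟨ S ⟩ × g x ≡ y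

NormalIn : {n : ℕ} → (Sub n → Set) → (Perm n → Set) → Set
NormalIn B S = ∀ g → g ∈⟨ S ⟩ → ∀ L → B L → Σ _ λ M → B M × (τ L · g) ≗ᵖ (g · τ M)

-- Since B is the whole group of k-periodic elements of K, τ_M ∈ B just says that
-- (the indicator of) M is k-periodic.  The hypothesis τ_J τ_{J+1} ∈ B makes the
-- discrete derivative of J k-periodic, so the jump J(a+k) xor J(a) is independent
-- of a: J is either k-periodic or k-antiperiodic.  In the first case τ_J τ_{ℤ_n} ∈ B.
-- In the second, returning to J(0) after n = qk steps forces q even, so 2k ∣ n, and
-- L = ⋃_{i<k} [i,2k] (the lower half of every block of length 2k) is antiperiodic
-- too, hence τ_J τ_L ∈ B.  Either way the third generator may be multiplied by an
-- element of B, which does not change G.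
module Submission where

open import Defs
open import Algebra.Bundles using (CommutativeRing)
open import Data.Bool using (Bool; true; false; not; if_then_else_; _xor_; _∧_; T)
open import Data.Bool.Properties
  using ( not-involutive; not-¬; ∧-identityʳ; xor-assoc; xor-comm; xor-same; xor-identityʳ
        ; xor-annihilates-not; xor-∧-commutativeRing; if-float )
open import Data.Empty using (⊥-elim)
open import Data.Fin using (Fin; toℕ)
open import Data.Fin.Properties using (toℕ-fromℕ<; toℕ-injective; toℕ<n)
open import Data.Nat using (ℕ; zero; suc; _+_; _*_; _∸_; _<_; _≤_; _<ᵇ_; _≡ᵇ_; _<?_; NonZero; >-nonZero⁻¹)
open import Data.Nat.DivMod
open import Data.Nat.Divisibility using (_∣_; divides; _∣0; ∣-refl; ∣m∣n⇒∣m+n; n∣m*n; *-monoˡ-∣; m%n≡0⇒n∣m)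
open import Data.Nat.Properties
open import Data.Product using (_×_; Σ; _,_; proj₂)
open import Data.Sum using (_⊎_; inj₁; inj₂; [_,_]′)
open import Data.Unit using (tt)
open import Function using (_∘_)
open import Relation.Nullary using (yes; no)
open import Relation.Nullary.Decidable using (dec-true; dec-false)
open import Relation.Binary.PropositionalEquality
open ≡-Reasoning

open import Algebra.Properties.CommutativeSemigroup
  (CommutativeRing.+-commutativeSemigroup xor-∧-commutativeRing) using (interchange)

xor-cancelˡ : ∀ x y → x xor (x xor y) ≡ y
xor-cancelˡ x y = trans (sym (xor-assoc x x y)) (cong (_xor y) (xor-same x))

xor-cancelʳ : ∀ x y → (x xor y) xor y ≡ x
xor-cancelʳ x y = trans (xor-assoc x y y) (trans (cong (x xor_) (xor-same y)) (xor-identityʳ x))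

xor≡false⇒≡ : ∀ {x y} → x xor y ≡ false → x ≡ y
xor≡false⇒≡ {x} {y} eq = trans (sym (xor-cancelʳ x y)) (cong (_xor y) eq)

[m%d+n]%d≡[m+n]%d : ∀ m n d .{{_ : NonZero d}} → (m % d + n) % d ≡ (m + n) % d
[m%d+n]%d≡[m+n]%d m n d = begin
  (m % d + n) % d            ≡⟨ %-distribˡ-+ (m % d) n d ⟩
  (m % d % d + n % d) % d    ≡⟨ cong (λ t → (t + n % d) % d) (m%n%n≡m%n m d) ⟩
  (m % d + n % d) % d        ≡⟨ %-distribˡ-+ m n d ⟨
  (m + n) % d                ∎

Periodic : ℕ → (ℕ → Bool) → Set
Periodic p f = ∀ a → f (a + p) ≡ f a

Antiperiodic : ℕ → (ℕ → Bool) → Set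
Antiperiodic p f = ∀ a → f (a + p) ≡ not (f a)

Δ : (ℕ → Bool) → ℕ → Bool
Δ f a = f (suc a) xor f a

module _ {p : ℕ} {f : ℕ → Bool} where

  periodic-+* : Periodic p f → ∀ r q → f (r + q * p) ≡ f r
  periodic-+* per r zero    = cong f (+-identityʳ r)
  periodic-+* per r (suc q) = begin
    f (r + (p + q * p))  ≡⟨ cong (f ∘ (r +_)) (+-comm p (q * p)) ⟩
    f (r + (q * p + p))  ≡⟨ cong f (+-assoc r (q * p) p) ⟨
    f (r + q * p + p)    ≡⟨ per (r + q * p) ⟩
    f (r + q * p)        ≡⟨ periodic-+* per r q ⟩
    f r                  ∎

  Δ-periodic⇒periodic⊎antiperiodic : Periodic p (Δ f) → Periodic p f ⊎ Antiperiodic p f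
  Δ-periodic⇒periodic⊎antiperiodic Δ-per = classify (f p xor f 0) λ a → begin
      f (a + p)                       ≡⟨ xor-cancelʳ (f (a + p)) (f a) ⟨
      (f (a + p) xor f a) xor f a     ≡⟨ cong (_xor f a) (jump-constant a) ⟩
      (f p xor f 0) xor f a           ∎
    where
    jump-constant : ∀ a → f (a + p) xor f a ≡ f p xor f 0
    jump-constant zero    = refl
    jump-constant (suc a) = trans (xor≡false⇒≡ (begin
      (f (suc a + p) xor f (suc a)) xor (f (a + p) xor f a)  ≡⟨ interchange (f (suc a + p)) (f (suc a)) (f (a + p)) (f a) ⟩
      Δ f (a + p) xor Δ f a                                  ≡⟨ cong (_xor Δ f a) (Δ-per a) ⟩
      Δ f a xor Δ f a                                        ≡⟨ xor-same (Δ f a) ⟩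
      false                                                  ∎)) (jump-constant a)

    classify : ∀ e → (∀ a → f (a + p) ≡ e xor f a) → Periodic p f ⊎ Antiperiodic p f
    classify false = inj₁
    classify true  = inj₂

  antiperiodic⇒2∣ : Antiperiodic p f → ∀ q → f (q * p) ≡ f 0 → 2 ∣ q
  antiperiodic⇒2∣ anti zero          _  = 2 ∣0
  antiperiodic⇒2∣ anti (suc zero)    eq =
    ⊥-elim (not-¬ refl (trans (sym eq) (trans (cong f (*-identityˡ p)) (anti 0))))
  antiperiodic⇒2∣ anti (suc (suc q)) eq =
    ∣m∣n⇒∣m+n ∣-refl (antiperiodic⇒2∣ anti q (trans (sym two-steps) eq))
    where
    two-steps : f (suc (suc q) * p) ≡ f (q * p)
    two-steps = begin
      f (p + (p + q * p))    ≡⟨ cong f (trans (+-comm p _) (cong (_+ p) (+-comm p (q * p)))) ⟩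
      f (q * p + p + p)      ≡⟨ anti (q * p + p) ⟩
      not (f (q * p + p))    ≡⟨ cong not (anti (q * p)) ⟩
      not (not (f (q * p)))  ≡⟨ not-involutive (f (q * p)) ⟩
      f (q * p)              ∎

antiperiodic-xor : ∀ {p f g} → Antiperiodic p f → Antiperiodic p g → Periodic p (λ a → f a xor g a)
antiperiodic-xor {f = f} {g} f-anti g-anti a =
  trans (cong₂ _xor_ (f-anti a) (g-anti a)) (xor-annihilates-not (f a) (g a))

lowerHalf-antiperiodic : ∀ k → Antiperiodic (suc k) (λ a → a % (2 * suc k) <ᵇ suc k)
lowerHalf-antiperiodic k a =
  trans (cong (_<ᵇ K) (sym ([m%d+n]%d≡[m+n]%d a K d))) (flip (a % d) (m%n<n a d))
  where
  K d : ℕ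
  K = suc k
  d = 2 * K
  K+K≡d : K + K ≡ d
  K+K≡d = cong (K +_) (sym (+-identityʳ K))
  flip : ∀ r → r < d → ((r + K) % d <ᵇ K) ≡ not (r <ᵇ K)
  flip r r<d with r <? K
  ... | yes r<K = begin
    (r + K) % d <ᵇ K   ≡⟨ cong (_<ᵇ K) (m<n⇒m%n≡m (subst (r + K <_) K+K≡d (+-monoˡ-< K r<K))) ⟩
    r + K <ᵇ K         ≡⟨ dec-false (r + K <? K) (m+n≮n r K) ⟩
    false              ≡⟨ cong not (dec-true (r <? K) r<K) ⟨
    not (r <ᵇ K)       ∎
  ... | no r≮K = begin
    (r + K) % d <ᵇ K     ≡⟨ cong (λ t → t % d <ᵇ K) r+K≡r∸K+d ⟩
    (r ∸ K + d) % d <ᵇ K ≡⟨ cong (_<ᵇ K) ([m+n]%n≡m%n (r ∸ K) d) ⟩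
    (r ∸ K) % d <ᵇ K     ≡⟨ cong (_<ᵇ K) (m<n⇒m%n≡m (<-≤-trans r∸K<K (m≤m+n K _))) ⟩
    r ∸ K <ᵇ K           ≡⟨ dec-true (r ∸ K <? K) r∸K<K ⟩
    true                 ≡⟨ cong not (dec-false (r <? K) r≮K) ⟨
    not (r <ᵇ K)         ∎
    where
    K≤r : K ≤ r
    K≤r = ≮⇒≥ r≮K
    r+K≡r∸K+d : r + K ≡ r ∸ K + d
    r+K≡r∸K+d = begin
      r + K            ≡⟨ cong (_+ K) (m∸n+n≡m K≤r) ⟨
      r ∸ K + K + K    ≡⟨ +-assoc (r ∸ K) K K ⟩
      r ∸ K + (K + K)  ≡⟨ cong (r ∸ K +_) K+K≡d ⟩
      r ∸ K + d        ∎
    r∸K<K : r ∸ K < K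
    r∸K<K = subst (r ∸ K <_) (m+n∸n≡m K K) (∸-monoˡ-< (subst (r <_) (sym K+K≡d) r<d) K≤r)

prefix : ℕ → (ℕ → Bool) → ℕ → Bool
prefix m c r = (r <ᵇ m) ∧ c r

prefix-< : ∀ {m r} c → r < m → prefix m c r ≡ c r
prefix-< {m} {r} c r<m = cong (_∧ c r) (dec-true (r <? m) r<m)

prefix-suc : ∀ m c r → prefix (suc m) c r ≡ prefix m c r xor (if c m then r ≡ᵇ m else false)
prefix-suc zero    c zero with c 0
... | false = refl
... | true  = refl
prefix-suc (suc m) c zero with c (suc m)
... | false = sym (xor-identityʳ (c 0))
... | true  = sym (xor-identityʳ (c 0))
prefix-suc zero    c (suc r) with c 0
... | false = refl
... | true  = refl
prefix-suc (suc m) c (suc r) = prefix-suc m (c ∘ suc) r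

xorSum-bracket : ∀ {n} d c m (j : Fin n) →
  xorSum m (λ i → if c i then bracket (suc d) i else ∅ˢ) j ≡ prefix m c (toℕ j % suc d)
xorSum-bracket d c zero    j = refl
xorSum-bracket {n} d c (suc m) j = begin
  xorSum m F j xor (if c m then bracket (suc d) m else ∅ˢ) j
    ≡⟨ cong₂ _xor_ (xorSum-bracket d c m j) (if-float (λ M → M j) (c m) {bracket (suc d) m} {∅ˢ}) ⟩
  prefix m c r xor (if c m then r ≡ᵇ m else false)
    ≡⟨ prefix-suc m c r ⟨
  prefix (suc m) c r
    ∎
  where
  F : ℕ → Sub n
  F i = if c i then bracket (suc d) i else ∅ˢ
  r : ℕ
  r = toℕ j % suc d

largestK-intro : ∀ {n} k (M : Sub n) (c : ℕ → Bool) → (∀ j → M j ≡ c (toℕ j % suc k)) → LargestK (suc k) M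
largestK-intro k M c M≡c = c , λ j → begin
  M j                                ≡⟨ M≡c j ⟩
  c (toℕ j % suc k)                  ≡⟨ prefix-< c (m%n<n (toℕ j) (suc k)) ⟨
  prefix (suc k) c (toℕ j % suc k)   ≡⟨ xorSum-bracket k c (suc k) j ⟨
  _                                  ∎

bracket-largestK : ∀ {n} k → LargestK {n} (suc k) (bracket (suc k) 0)
bracket-largestK k = largestK-intro k _ (_≡ᵇ 0) (λ _ → refl)

module _ {n : ℕ} .{{_ : NonZero n}} where

  -- A subset of ℤ_n read as an n-periodic Boolean sequence on ℕ; all periodicity
  -- arguments happen on ℕ, where translation by k is plain addition.
  infix 9 _at_
  _at_ : Sub n → ℕ → Bool
  M at a = M (finMod a)

  toℕ-finMod : ∀ a → toℕ (finMod {n} a) ≡ a % n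
  toℕ-finMod a = toℕ-fromℕ< (m%n<n a n)

  at-cong : ∀ M {a b} → a % n ≡ b % n → M at a ≡ M at b
  at-cong M {a} {b} eq = cong M (toℕ-injective (trans (toℕ-finMod a) (trans eq (sym (toℕ-finMod b)))))

  at-toℕ : ∀ M j → M at toℕ j ≡ M j
  at-toℕ M j = cong M (toℕ-injective (trans (toℕ-finMod (toℕ j)) (m<n⇒m%n≡m (toℕ<n j))))

  at-periodic : ∀ M → Periodic n (M at_)
  at-periodic M a = at-cong M ([m+n]%n≡m%n a n)

  n∣k+[n∸k%n] : ∀ k → n ∣ k + (n ∸ k % n)
  n∣k+[n∸k%n] k = subst (n ∣_) (sym k+[n∸k%n]≡q*n+n) (∣m∣n⇒∣m+n (n∣m*n (k / n)) ∣-refl)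
    where
    k+[n∸k%n]≡q*n+n : k + (n ∸ k % n) ≡ k / n * n + n
    k+[n∸k%n]≡q*n+n = begin
      k + (n ∸ k % n)                    ≡⟨ cong (_+ (n ∸ k % n)) (m≡m%n+[m/n]*n k n) ⟩
      k % n + k / n * n + (n ∸ k % n)    ≡⟨ cong (_+ (n ∸ k % n)) (+-comm (k % n) _) ⟩
      k / n * n + k % n + (n ∸ k % n)    ≡⟨ +-assoc (k / n * n) _ _ ⟩
      k / n * n + (k % n + (n ∸ k % n))  ≡⟨ cong (k / n * n +_) (m+[n∸m]≡n (m%n≤n k n)) ⟩
      k / n * n + n                      ∎

  +ˢ-at : ∀ M k a → (M +ˢ k) at (a + k) ≡ M at a
  +ˢ-at M k a = at-cong M (begin
    (toℕ (finMod {n} (a + k)) + (n ∸ k % n)) % n  ≡⟨ cong (λ t → (t + (n ∸ k % n)) % n) (toℕ-finMod (a + k)) ⟩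
    ((a + k) % n + (n ∸ k % n)) % n              ≡⟨ [m%d+n]%d≡[m+n]%d (a + k) _ n ⟩
    (a + k + (n ∸ k % n)) % n                    ≡⟨ cong (_% n) (+-assoc a k _) ⟩
    (a + (k + (n ∸ k % n))) % n                  ≡⟨ %-remove-+ʳ a (n∣k+[n∸k%n] k) ⟩
    a % n                                        ∎)

  +ˢ-invariant⇒periodic : ∀ {M p} → (M +ˢ p) ≗ˢ M → Periodic p (M at_)
  +ˢ-invariant⇒periodic {M} {p} M+p≗M a = trans (sym (M+p≗M (finMod (a + p)))) (+ˢ-at M p a)

  ⊕+ˢ1-periodic⇒Δ-periodic : ∀ {J p} → Periodic p ((J ⊕ (J +ˢ 1)) at_) → Periodic p (Δ (J at_))
  ⊕+ˢ1-periodic⇒Δ-periodic {J} {p} per a = trans (sym (at-suc (a + p))) (trans (per (suc a)) (at-suc a))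
    where
    at-suc : ∀ b → (J ⊕ (J +ˢ 1)) at suc b ≡ Δ (J at_) b
    at-suc b = cong (J at suc b xor_) (trans (cong ((J +ˢ 1) at_) (+-comm 1 b)) (+ˢ-at J 1 b))

  periodic⇒largestK : ∀ k {M} → Periodic (suc k) (M at_) → LargestK (suc k) M
  periodic⇒largestK k {M} per = largestK-intro k M (M at_) λ j → begin
    M j                                            ≡⟨ at-toℕ M j ⟨
    M at toℕ j                                     ≡⟨ cong (M at_) (m≡m%n+[m/n]*n (toℕ j) (suc k)) ⟩
    M at (toℕ j % suc k + toℕ j / suc k * suc k)   ≡⟨ periodic-+* per (toℕ j % suc k) (toℕ j / suc k) ⟩
    M at (toℕ j % suc k)                           ∎

  bracket-periodic⇒∣ : ∀ k → suc k ≤ n → Periodic (suc k) (bracket (suc k) 0 at_) → suc k ∣ n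
  bracket-periodic⇒∣ k K≤n per = m%n≡0⇒n∣m n K (≡ᵇ⇒≡ r 0 (subst T (sym r≡ᵇ0) tt))
    where
    K r : ℕ
    K = suc k
    r = n % K
    f : ℕ → Bool
    f = bracket K 0 at_
    r%n%K≡r : r % n % K ≡ r
    r%n%K≡r = trans (cong (_% K) (m<n⇒m%n≡m (<-≤-trans (m%n<n n K) K≤n))) (m%n%n≡m%n n K)
    f-at : ∀ a → f a ≡ (a % n % K ≡ᵇ 0)
    f-at a = cong (λ t → t % K ≡ᵇ 0) (toℕ-finMod a)
    r≡ᵇ0 : (r ≡ᵇ 0) ≡ true
    r≡ᵇ0 = begin
      (r ≡ᵇ 0)          ≡⟨ cong (_≡ᵇ 0) r%n%K≡r ⟨
      (r % n % K ≡ᵇ 0)  ≡⟨ f-at r ⟨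
      f r               ≡⟨ periodic-+* per r (n / K) ⟨
      f (r + n / K * K) ≡⟨ cong f (m≡m%n+[m/n]*n n K) ⟨
      f n               ≡⟨ at-periodic (bracket K 0) 0 ⟩
      f 0               ≡⟨ f-at 0 ⟩
      (0 % n % K ≡ᵇ 0)  ≡⟨ cong (λ t → t % K ≡ᵇ 0) (m<n⇒m%n≡m (>-nonZero⁻¹ n)) ⟩
      true              ∎

  antiperiodic⇒2*∣ : ∀ {K M} → Antiperiodic K (M at_) → K ∣ n → 2 * K ∣ n
  antiperiodic⇒2*∣ {K} {M} anti (divides q n≡q*K) =
    subst (2 * K ∣_) (sym n≡q*K) (*-monoˡ-∣ K (antiperiodic⇒2∣ anti q M[q*K]≡M[0]))
    where
    M[q*K]≡M[0] : M at (q * K) ≡ M at 0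
    M[q*K]≡M[0] = trans (cong (M at_) (sym n≡q*K)) (at-periodic M 0)

  prodBracket-antiperiodic : ∀ k → 2 * suc k ∣ n → Antiperiodic (suc k) (prodBracket (suc k) at_)
  prodBracket-antiperiodic k 2K∣n a = begin
    prodBracket K at (a + K)  ≡⟨ prodBracket-at (a + K) ⟩
    ((a + K) % (2 * K) <ᵇ K)  ≡⟨ lowerHalf-antiperiodic k a ⟩
    not (a % (2 * K) <ᵇ K)    ≡⟨ cong not (prodBracket-at a) ⟨
    not (prodBracket K at a)  ∎
    where
    K : ℕ
    K = suc k
    prodBracket-at : ∀ a → prodBracket K at a ≡ (a % (2 * K) <ᵇ K)
    prodBracket-at a = begin
      prodBracket K at a                                     ≡⟨ xorSum-bracket _ (λ _ → true) K (finMod a) ⟩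
      prefix K (λ _ → true) (toℕ (finMod {n} a) % (2 * K))  ≡⟨ ∧-identityʳ _ ⟩
      (toℕ (finMod {n} a) % (2 * K) <ᵇ K)                    ≡⟨ cong (λ t → t % (2 * K) <ᵇ K) (toℕ-finMod a) ⟩
      (a % n % (2 * K) <ᵇ K)                                 ≡⟨ cong (_<ᵇ K) (m∣n⇒o%n%m≡o%m (2 * K) n a 2K∣n) ⟩
      (a % (2 * K) <ᵇ K)                                     ∎

τ-· : ∀ {n} {L M X : Sub n} → (∀ i → L i xor M i ≡ X i) → (τ L · τ M) ≗ᵖ τ X
τ-· {L = L} {M} L⊕M≗X (i , l , d) rewrite sym (L⊕M≗X i) with L i | M i
... | false | _     = refl
... | true  | false = refl
... | true  | true  = cong (λ b → i , b , d) (not-involutive l)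

module _ {n : ℕ} {S S′ : Perm n → Set} (S⊆⟨S′⟩ : ∀ g → S g → g ∈⟨ S′ ⟩) where

  Gen⇒∈⟨⟩ : ∀ {g} → Gen S g → g ∈⟨ S′ ⟩
  Gen⇒∈⟨⟩ (gen s) = S⊆⟨S′⟩ _ s
  Gen⇒∈⟨⟩ one     = _ , one , λ _ → refl
  Gen⇒∈⟨⟩ (mul a b) with Gen⇒∈⟨⟩ a | Gen⇒∈⟨⟩ b
  ... | g , Gg , g≗ | h , Gh , h≗ = g · h , mul Gg Gh , λ x → trans (cong h (g≗ x)) (h≗ _)
  Gen⇒∈⟨⟩ (inv {h = h} a left right) with Gen⇒∈⟨⟩ a
  ... | g , Gg , g≗ =
    h , inv Gg (λ x → trans (cong h (g≗ x)) (left x)) (λ x → trans (g≗ (h x)) (right x)) , λ _ → refl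

  ∈⟨⟩-mono : ∀ g → g ∈⟨ S ⟩ → g ∈⟨ S′ ⟩
  ∈⟨⟩-mono g (h , Gh , h≗g) with Gen⇒∈⟨⟩ Gh
  ... | h′ , Gh′ , h′≗h = h′ , Gh′ , λ x → trans (h′≗h x) (h≗g x)

gensB-⊆ : ∀ {n} B (x y y′ : Perm n) X → B X → (y′ · τ X) ≗ᵖ y →
          ∀ g → g ∈⟨ GensB B x y ⟩ → g ∈⟨ GensB B x y′ ⟩
gensB-⊆ B x y y′ X X∈B y≗ = ∈⟨⟩-mono generator
  where
  generator : ∀ g → GensB B x y g → g ∈⟨ GensB B x y′ ⟩
  generator g (inj₁ g∈B)        = g , gen (inj₁ g∈B) , λ _ → refl
  generator g (inj₂ (inj₁ g≗x)) = g , gen (inj₂ (inj₁ g≗x)) , λ _ → refl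
  generator g (inj₂ (inj₂ g≗y)) =
    y′ · τ X , mul (gen (inj₂ (inj₂ λ _ → refl))) (gen (inj₁ (X , X∈B , λ _ → refl))) ,
    λ z → trans (y≗ z) (sym (g≗y z))

sameGroup-τ : ∀ {n} B (x y : Perm n) J L → B (L ⊕ J) → SameGroup B x (y · τ J) x (y · τ L)
sameGroup-τ B x y J L L⊕J∈B g =
  gensB-⊆ B x (y · τ J) (y · τ L) (L ⊕ J) L⊕J∈B (τ-· {L = L} {L ⊕ J} {J} (λ i → xor-cancelˡ (L i) (J i)) ∘ y) g ,
  gensB-⊆ B x (y · τ L) (y · τ J) (L ⊕ J) L⊕J∈B (τ-· {L = J} {L ⊕ J} {L} J⊕[L⊕J]≗L ∘ y) g
  where
  J⊕[L⊕J]≗L : ∀ i → J i xor (L i xor J i) ≡ L i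
  J⊕[L⊕J]≗L i = trans (cong (J i xor_) (xor-comm (L i) (J i))) (xor-cancelˡ (J i) (L i))

lemma3p2 : (n : ℕ) .{{_ : NonZero n}} (B : Sub n → Set) (ε : Bool) (J : Sub n) (k : ℕ) →
    IsSubgroupK B →
    (Σ (Sub n) λ L → B L × Σ (Fin n) λ j → L j ≡ true) →
    ArcTransitive (GensB B (ρ · τ₀^ ε) ((σ · τ₀^ ε) · τ J)) →
    NormalIn B (GensB B (ρ · τ₀^ ε) ((σ · τ₀^ ε) · τ J)) →
    (T ε → B fullˢ) →
    B (J ⊕ negˢ J) →
    B (J ⊕ (J +ˢ 1)) →
    IsExactPeriod B k →
    (∀ L → (B L → LargestK k L) × (LargestK k L → B L)) →
    Σ (Sub n) λ L →
      (L ≗ˢ fullˢ ⊎ ((2 * k) ∣ n × L ≗ˢ prodBracket k)) ×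
      SameGroup B (ρ · τ₀^ ε) ((σ · τ₀^ ε) · τ J) (ρ · τ₀^ ε) ((σ · τ₀^ ε) · τ L)
lemma3p2 n B ε J zero    _ _ _ _ _ _ _ ((() , _) , _) _
lemma3p2 n B ε J (suc k) _ _ _ _ _ _ J⊕J+1∈B ((_ , K≤n , B-periodic) , _) B⇔LargestK =
  [ (λ J-periodic →
      fullˢ , inj₁ (λ _ → refl) , sameGroup fullˢ (periodic⇒∈B (fullˢ ⊕ J) (cong not ∘ J-periodic)))
  , (λ J-antiperiodic → let 2K∣n = antiperiodic⇒2*∣ {M = J} J-antiperiodic K∣n in
      prodBracket K , inj₂ (2K∣n , λ _ → refl) ,
      sameGroup (prodBracket K) (periodic⇒∈B (prodBracket K ⊕ J)
        (antiperiodic-xor (prodBracket-antiperiodic k 2K∣n) J-antiperiodic)))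
  ]′ (Δ-periodic⇒periodic⊎antiperiodic (⊕+ˢ1-periodic⇒Δ-periodic {J = J} (∈B⇒periodic J⊕J+1∈B)))
  where
  K : ℕ
  K = suc k
  ∈B⇒periodic : ∀ {M} → B M → Periodic K (M at_)
  ∈B⇒periodic M∈B = +ˢ-invariant⇒periodic (B-periodic _ M∈B)
  periodic⇒∈B : ∀ M → Periodic K (M at_) → B M
  periodic⇒∈B M per = proj₂ (B⇔LargestK _) (periodic⇒largestK k per)
  K∣n : K ∣ n
  K∣n = bracket-periodic⇒∣ k K≤n (∈B⇒periodic (proj₂ (B⇔LargestK _) (bracket-largestK k)))
  sameGroup : ∀ L → B (L ⊕ J) → SameGroup B (ρ · τ₀^ ε) ((σ · τ₀^ ε) · τ J) (ρ · τ₀^ ε) ((σ · τ₀^ ε) · τ L)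
  sameGroup = sameGroup-τ B (ρ · τ₀^ ε) (σ · τ₀^ ε) J
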